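{- Let $\mathbf{L}$ be a complete residuated lattice, $F$ a type, $\langle M,F^{\mathbf{M}}\rangle$ an (ordinary) algebra of type $F$, and $\preccurlyeq^{\mathbf{M}}$ a binary $\mathbf{L}$-relation on $M$ such that for all $a,b,c,a_1,b_1,\dots,a_n,b_n\in M$ and every $n$-ary $f\in F$: $a\preccurlyeq^{\mathbf{M}} a=1$; $(a\preccurlyeq^{\mathbf{M}} b)\otimes(b\preccurlyeq^{\mathbf{M}} c)\le a\preccurlyeq^{\mathbf{M}} c$; and $(a_1\preccurlyeq^{\mathbf{M}} b_1)\otimes\cdots\otimes(a_n\preccurlyeq^{\mathbf{M}} b_n)\le f^{\mathbf{M}}(a_1,\dots,a_n)\preccurlyeq^{\mathbf{M}} f^{\mathbf{M}}(b_1,\dots,b_n)$. If for any distinct $a,b\in M$ we have $a\preccurlyeq^{\mathbf{M}} b\neq 1$ or $b\preccurlyeq^{\mathbf{M}} a\neq 1$, then $\langle M,\approx^{\mathbf{M}},\preccurlyeq^{\mathbf{M}},F^{\mathbf{M}}\rangle$ with $\approx^{\mathbf{M}}=\preccurlyeq^{\mathbf{M}}\cap\succcurlyeq^{\mathbf{M}}$ (i.e. $a\approx^{\mathbf{M}} b=(a\preccurlyeq^{\mathbf{M}} b)\wedge(b\preccurlyeq^{\mathbf{M}} a)$) is an algebra with $\mathbf{L}$-equality and $\mathbf{L}$-order.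
   Context: A complete residuated lattice is an algebra $\langle L,\wedge,\vee,\otimes,\rightarrow,0,1\rangle$ where $\langle L,\wedge,\vee,0,1\rangle$ is a complete lattice, $\langle L,\otimes,1\rangle$ is a commutative monoid, and $a\otimes b\le c$ iff $a\le b\rightarrow c$. A binary $\mathbf{L}$-relation on $M$ is a map $M\times M\to L$, written infix; $\succcurlyeq$ denotes the inverse of $\preccurlyeq$ and $\cap$ is the pointwise infimum. An algebra with $\mathbf{L}$-equality of type $F$ is $\langle M,\approx^{\mathbf{M}},F^{\mathbf{M}}\rangle$ where $\langle M,F^{\mathbf{M}}\rangle$ is an algebra of type $F$ and $\approx^{\mathbf{M}}$ is a binary $\mathbf{L}$-relation with: $a\approx^{\mathbf{M}} b=1$ iff $a=b$; $a\approx^{\mathbf{M}} b=b\approx^{\mathbf{M}} a$; $(a\approx^{\mathbf{M}} b)\otimes(b\approx^{\mathbf{M}} c)\le a\approx^{\mathbf{M}} c$; $(a_1\approx^{\mathbf{M}} b_1)\otimes\cdots\otimes(a_n\approx^{\mathbf{M}} b_n)\le f^{\mathbf{M}}(a_1,\dots,a_n)\approx^{\mathbf{M}} f^{\mathbf{M}}(b_1,\dots,b_n)$. An algebra with $\mathbf{L}$-equality and $\mathbf{L}$-order is $\langle M,\approx^{\mathbf{M}},\preccurlyeq^{\mathbf{M}},F^{\mathbf{M}}\rangle$ where $\langle M,\approx^{\mathbf{M}},F^{\mathbf{M}}\rangle$ is an algebra with $\mathbf{L}$-equality and $\preccurlyeq^{\mathbf{M}}$ is a binary $\mathbf{L}$-relation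 with, for all elements and $n$-ary $f\in F$: $a\preccurlyeq^{\mathbf{M}} a=1$; $(a\preccurlyeq^{\mathbf{M}} b)\wedge(b\preccurlyeq^{\mathbf{M}} a)\le a\approx^{\mathbf{M}} b$; $(a\preccurlyeq^{\mathbf{M}} b)\otimes(b\preccurlyeq^{\mathbf{M}} c)\le a\preccurlyeq^{\mathbf{M}} c$; $(a_1\approx^{\mathbf{M}} b_1)\otimes(a_2\approx^{\mathbf{M}} b_2)\le(a_1\preccurlyeq^{\mathbf{M}} a_2)\rightarrow(b_1\preccurlyeq^{\mathbf{M}} b_2)$; $(a_1\preccurlyeq^{\mathbf{M}} b_1)\otimes\cdots\otimes(a_n\preccurlyeq^{\mathbf{M}} b_n)\le f^{\mathbf{M}}(a_1,\dots,a_n)\preccurlyeq^{\mathbf{M}} f^{\mathbf{M}}(b_1,\dots,b_n)$. -}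

module Defs where

open import Level using (Level; _⊔_) renaming (suc to lsuc)
open import Data.Nat using (ℕ; zero; suc)
open import Data.Fin using (Fin; zero; suc)
open import Data.Product using (_×_; _,_)
open import Function using (_∘_)
open import Relation.Binary.PropositionalEquality using (_≡_)

record CompleteResiduatedLattice (ℓ : Level) : Set (lsuc ℓ) where
  infix  4 _≤_
  infixr 7 _⊗_
  infixr 6 _∧_
  infixr 6 _∨_
  infixr 5 _⇒_
  field
    Carrier : Set ℓ
    _≤_     : Carrier → Carrier → Set ℓ
    ≤-refl    : ∀ {a} → a ≤ a
    ≤-antisym : ∀ {a b} → a ≤ b → b ≤ a → a ≡ b
    ≤-trans   : ∀ {a b c} → a ≤ b → b ≤ c → a ≤ c
    _∧_ _∨_ : Carrier → Carrier → Carrier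
    ∧-lb₁ : ∀ a b → a ∧ b ≤ a
    ∧-lb₂ : ∀ a b → a ∧ b ≤ b
    ∧-glb : ∀ {a b c} → c ≤ a → c ≤ b → c ≤ a ∧ b
    ∨-ub₁ : ∀ a b → a ≤ a ∨ b
    ∨-ub₂ : ∀ a b → b ≤ a ∨ b
    ∨-lub : ∀ {a b c} → a ≤ c → b ≤ c → a ∨ b ≤ c
    ⋀ ⋁ : (Carrier → Set ℓ) → Carrier
    ⋀-lb  : ∀ (S : Carrier → Set ℓ) {a} → S a → ⋀ S ≤ a
    ⋀-glb : ∀ (S : Carrier → Set ℓ) {c} → (∀ {a} → S a → c ≤ a) → c ≤ ⋀ S
    ⋁-ub  : ∀ (S : Carrier → Set ℓ) {a} → S a → a ≤ ⋁ S
    ⋁-lub : ∀ (S : Carrier → Set ℓ) {c} → (∀ {a} → S a → a ≤ c) → ⋁ S ≤ c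
    𝟘 𝟙 : Carrier
    𝟘-least    : ∀ a → 𝟘 ≤ a
    𝟙-greatest : ∀ a → a ≤ 𝟙
    _⊗_ : Carrier → Carrier → Carrier
    ⊗-assoc    : ∀ a b c → (a ⊗ b) ⊗ c ≡ a ⊗ (b ⊗ c)
    ⊗-comm     : ∀ a b → a ⊗ b ≡ b ⊗ a
    ⊗-identity : ∀ a → 𝟙 ⊗ a ≡ a
    _⇒_ : Carrier → Carrier → Carrier
    residuation₁ : ∀ {a b c} → a ⊗ b ≤ c → a ≤ b ⇒ c
    residuation₂ : ∀ {a b c} → a ≤ b ⇒ c → a ⊗ b ≤ c

record Type (s : Level) : Set (lsuc s) where
  field
    Sym   : Set s
    arity : Sym → ℕ

record Algebra {s : Level} (F : Type s) (m : Level) : Set (s ⊔ lsuc m) where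
  open Type F
  field
    Carrier : Set m
    op      : (f : Sym) → (Fin (arity f) → Carrier) → Carrier

module _ {ℓ} (𝐋 : CompleteResiduatedLattice ℓ) where
  open CompleteResiduatedLattice 𝐋

  ⨂ : ∀ {n} → (Fin n → Carrier) → Carrier
  ⨂ {zero}  x = 𝟙
  ⨂ {suc n} x = x zero ⊗ ⨂ (x ∘ suc)

  LRel : ∀ {m} → Set m → Set (ℓ ⊔ m)
  LRel M = M → M → Carrier

  _ᵒ : ∀ {m} {M : Set m} → LRel M → LRel M
  (R ᵒ) a b = R b a

  _∩_ : ∀ {m} {M : Set m} → LRel M → LRel M → LRel M
  (R ∩ S) a b = R a b ∧ S a b

  module _ {s m} {F : Type s} (𝐌 : Algebra F m) where
    open Type F
    open Algebra 𝐌 renaming (Carrier to M)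

    record IsAlgebraWithLEquality (_≈_ : LRel M) : Set (ℓ ⊔ s ⊔ m) where
      field
        ≈-one⇒eq : ∀ a b → a ≈ b ≡ 𝟙 → a ≡ b
        eq⇒≈-one : ∀ a b → a ≡ b → a ≈ b ≡ 𝟙
        ≈-sym    : ∀ a b → a ≈ b ≡ b ≈ a
        ≈-trans  : ∀ a b c → (a ≈ b) ⊗ (b ≈ c) ≤ a ≈ c
        ≈-compat : ∀ (f : Sym) (as bs : Fin (arity f) → M) →
                   ⨂ (λ i → as i ≈ bs i) ≤ op f as ≈ op f bs

    record IsAlgebraWithLEqualityAndLOrder (_≈_ _≼_ : LRel M) : Set (ℓ ⊔ s ⊔ m) where
      field
        isAlgebraWithLEquality : IsAlgebraWithLEquality _≈_
        ≼-refl    : ∀ a → a ≼ a ≡ 𝟙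
        ≼-antisym : ∀ a b → (a ≼ b) ∧ (b ≼ a) ≤ a ≈ b
        ≼-trans   : ∀ a b c → (a ≼ b) ⊗ (b ≼ c) ≤ a ≼ c
        ≼-≈-compat : ∀ a₁ b₁ a₂ b₂ → (a₁ ≈ b₁) ⊗ (a₂ ≈ b₂) ≤ (a₁ ≼ a₂) ⇒ (b₁ ≼ b₂)
        ≼-compat  : ∀ (f : Sym) (as bs : Fin (arity f) → M) →
                    ⨂ (λ i → as i ≼ bs i) ≤ op f as ≼ op f bs

-- Every required law of ≈ := ≼ ∩ ≼ᵒ follows componentwise from the matching law of ≼, using
-- only that ⊗ is monotone (a consequence of residuation) and ⨂ (x ∧ y) ≤ ⨂ x ∧ ⨂ y.
-- Antisymmetry of ≼ holds with equality by construction, and the compatibility of ≼ with ≈ is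
-- transitivity of ≼ applied twice: b₁ ≼ a₁ ≼ a₂ ≼ b₂. The hypothesis on distinct elements is
-- exactly what makes ≈ separate points.
module Submission where

open import Level using (Level; _⊔_)
open import Data.Nat using (zero; suc)
open import Data.Fin using (Fin; zero; suc)
open import Relation.Binary.PropositionalEquality using (_≡_; refl; sym; trans; cong; isEquivalence)
open import Relation.Binary.Bundles using (Preorder)
import Relation.Binary.Reasoning.Preorder as PreorderReasoning
open import Defs

module ResiduatedLatticeProperties {ℓ} (𝐋 : CompleteResiduatedLattice ℓ) where
  open CompleteResiduatedLattice 𝐋

  ≡⇒≤ : ∀ {a b} → a ≡ b → a ≤ b
  ≡⇒≤ refl = ≤-refl

  𝟙≤⇒≡𝟙 : ∀ {a} → 𝟙 ≤ a → a ≡ 𝟙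
  𝟙≤⇒≡𝟙 = ≤-antisym (𝟙-greatest _)

  ∧-comm : ∀ a b → a ∧ b ≡ b ∧ a
  ∧-comm a b = ≤-antisym (∧-glb (∧-lb₂ a b) (∧-lb₁ a b)) (∧-glb (∧-lb₂ b a) (∧-lb₁ b a))

  ⊗-monoˡ : ∀ {a a′ b} → a ≤ a′ → a ⊗ b ≤ a′ ⊗ b
  ⊗-monoˡ a≤a′ = residuation₂ (≤-trans a≤a′ (residuation₁ ≤-refl))

  ⊗-mono : ∀ {a a′ b b′} → a ≤ a′ → b ≤ b′ → a ⊗ b ≤ a′ ⊗ b′
  ⊗-mono {a′ = a′} {b} {b′} a≤a′ b≤b′ =
    ≤-trans (⊗-monoˡ a≤a′)
      (≤-trans (≡⇒≤ (⊗-comm a′ b)) (≤-trans (⊗-monoˡ b≤b′) (≡⇒≤ (⊗-comm b′ a′))))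

  ⨂-mono : ∀ {n} {x y : Fin n → Carrier} → (∀ i → x i ≤ y i) → ⨂ 𝐋 x ≤ ⨂ 𝐋 y
  ⨂-mono {zero}  x≤y = ≤-refl
  ⨂-mono {suc n} x≤y = ⊗-mono (x≤y zero) (⨂-mono (λ i → x≤y (suc i)))

  ∧-mono : ∀ {a a′ b b′} → a ≤ a′ → b ≤ b′ → a ∧ b ≤ a′ ∧ b′
  ∧-mono {a} {b = b} a≤a′ b≤b′ = ∧-glb (≤-trans (∧-lb₁ a b) a≤a′) (≤-trans (∧-lb₂ a b) b≤b′)

  ⨂-∧ : ∀ {n} (x y : Fin n → Carrier) → ⨂ 𝐋 (λ i → x i ∧ y i) ≤ ⨂ 𝐋 x ∧ ⨂ 𝐋 y
  ⨂-∧ x y = ∧-glb (⨂-mono (λ i → ∧-lb₁ (x i) (y i))) (⨂-mono (λ i → ∧-lb₂ (x i) (y i)))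

  ⊗-rotate : ∀ a b c → (a ⊗ b) ⊗ c ≡ a ⊗ (c ⊗ b)
  ⊗-rotate a b c = trans (⊗-assoc a b c) (cong (a ⊗_) (⊗-comm b c))

  ≤-preorder : Preorder ℓ ℓ ℓ
  ≤-preorder = record
    { _≈_ = _≡_
    ; _≲_ = _≤_
    ; isPreorder = record { isEquivalence = isEquivalence ; reflexive = ≡⇒≤ ; trans = ≤-trans }
    }

  module ≤-Reasoning = PreorderReasoning ≤-preorder

module LRelationProperties {ℓ} (𝐋 : CompleteResiduatedLattice ℓ) where
  open CompleteResiduatedLattice 𝐋
  open ResiduatedLatticeProperties 𝐋

  Reflexive : ∀ {m} {M : Set m} → LRel 𝐋 M → Set (ℓ ⊔ m)
  Reflexive R = ∀ a → R a a ≡ 𝟙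

  Transitive : ∀ {m} {M : Set m} → LRel 𝐋 M → Set (ℓ ⊔ m)
  Transitive R = ∀ a b c → R a b ⊗ R b c ≤ R a c

  Separating : ∀ {m} {M : Set m} → LRel 𝐋 M → Set (ℓ ⊔ m)
  Separating R = ∀ a b → R a b ≡ 𝟙 → R b a ≡ 𝟙 → a ≡ b

  Compatible : ∀ {s m} {F : Type s} (𝐌 : Algebra F m) → LRel 𝐋 (Algebra.Carrier 𝐌) → Set (ℓ ⊔ s ⊔ m)
  Compatible {F = F} 𝐌 R = ∀ (f : Type.Sym F) (as bs : Fin (Type.arity F f) → Algebra.Carrier 𝐌) →
    ⨂ 𝐋 (λ i → R (as i) (bs i)) ≤ R (Algebra.op 𝐌 f as) (Algebra.op 𝐌 f bs)

  module _ {m} {M : Set m} where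

    _ˢ : LRel 𝐋 M → LRel 𝐋 M
    R ˢ = _∩_ 𝐋 R (_ᵒ 𝐋 R)

    ˢ-sym : ∀ R a b → (R ˢ) a b ≡ (R ˢ) b a
    ˢ-sym R a b = ∧-comm (R a b) (R b a)

    ˢ-one⇒eq : ∀ {R} → Separating R → ∀ a b → (R ˢ) a b ≡ 𝟙 → a ≡ b
    ˢ-one⇒eq sep a b Rˢab≡𝟙 =
      sep a b (𝟙≤⇒≡𝟙 (≤-trans 𝟙≤Rˢab (∧-lb₁ _ _))) (𝟙≤⇒≡𝟙 (≤-trans 𝟙≤Rˢab (∧-lb₂ _ _)))
      where
      𝟙≤Rˢab : 𝟙 ≤ _
      𝟙≤Rˢab = ≡⇒≤ (sym Rˢab≡𝟙)

    eq⇒ˢ-one : ∀ {R} → Reflexive R → ∀ a b → a ≡ b → (R ˢ) a b ≡ 𝟙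
    eq⇒ˢ-one refl-R a .a refl = 𝟙≤⇒≡𝟙 (∧-glb 𝟙≤Raa 𝟙≤Raa)
      where
      𝟙≤Raa : 𝟙 ≤ _
      𝟙≤Raa = ≡⇒≤ (sym (refl-R a))

    ˢ-trans : ∀ {R} → Transitive R → Transitive (R ˢ)
    ˢ-trans trans-R a b c = ∧-glb
      (≤-trans (⊗-mono (∧-lb₁ _ _) (∧-lb₁ _ _)) (trans-R a b c))
      (≤-trans (⊗-mono (∧-lb₂ _ _) (∧-lb₂ _ _)) (≤-trans (≡⇒≤ (⊗-comm _ _)) (trans-R c b a)))

    respects-ˢ : ∀ {R} → Transitive R → ∀ a₁ b₁ a₂ b₂ →
                 (R ˢ) a₁ b₁ ⊗ (R ˢ) a₂ b₂ ≤ R a₁ a₂ ⇒ R b₁ b₂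
    respects-ˢ {R} trans-R a₁ b₁ a₂ b₂ = residuation₁ (begin
      ((R ˢ) a₁ b₁ ⊗ (R ˢ) a₂ b₂) ⊗ R a₁ a₂   ≲⟨ ⊗-monoˡ (⊗-mono (∧-lb₂ _ _) (∧-lb₁ _ _)) ⟩
      (R b₁ a₁ ⊗ R a₂ b₂) ⊗ R a₁ a₂           ≡⟨ ⊗-rotate _ _ _ ⟩
      R b₁ a₁ ⊗ (R a₁ a₂ ⊗ R a₂ b₂)           ≲⟨ ⊗-mono ≤-refl (trans-R a₁ a₂ b₂) ⟩
      R b₁ a₁ ⊗ R a₁ b₂                       ≲⟨ trans-R b₁ a₁ b₂ ⟩
      R b₁ b₂                                 ∎)
      where open ≤-Reasoning

  ˢ-compatible : ∀ {s m} {F : Type s} (𝐌 : Algebra F m) {R : LRel 𝐋 (Algebra.Carrier 𝐌)} →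
                 Compatible 𝐌 R → Compatible 𝐌 (R ˢ)
  ˢ-compatible 𝐌 {R} compat-R f as bs =
    ≤-trans (⨂-∧ (λ i → R (as i) (bs i)) (λ i → R (bs i) (as i)))
            (∧-mono (compat-R f as bs) (compat-R f bs as))

mainTheorem2 : ∀ {ℓ s m : Level} (𝐋 : CompleteResiduatedLattice ℓ) (F : Type s) (𝐌 : Algebra F m)
    (_≼_ : LRel 𝐋 (Algebra.Carrier 𝐌)) →
    (∀ a → a ≼ a ≡ CompleteResiduatedLattice.𝟙 𝐋) →
    (∀ a b c → CompleteResiduatedLattice._≤_ 𝐋 (CompleteResiduatedLattice._⊗_ 𝐋 (a ≼ b) (b ≼ c)) (a ≼ c)) →
    (∀ (f : Type.Sym F) (as bs : Fin (Type.arity F f) → Algebra.Carrier 𝐌) →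
      CompleteResiduatedLattice._≤_ 𝐋 (⨂ 𝐋 (λ i → as i ≼ bs i))
        (Algebra.op 𝐌 f as ≼ Algebra.op 𝐌 f bs)) →
    (∀ a b → a ≼ b ≡ CompleteResiduatedLattice.𝟙 𝐋 → b ≼ a ≡ CompleteResiduatedLattice.𝟙 𝐋 → a ≡ b) →
    IsAlgebraWithLEqualityAndLOrder 𝐋 𝐌 (_∩_ 𝐋 _≼_ (_ᵒ 𝐋 _≼_)) _≼_
mainTheorem2 𝐋 F 𝐌 _≼_ ≼-refl ≼-trans ≼-compat ≼-separating = record
  { isAlgebraWithLEquality = record
    { ≈-one⇒eq = ˢ-one⇒eq ≼-separating
    ; eq⇒≈-one = eq⇒ˢ-one ≼-refl
    ; ≈-sym    = ˢ-sym _≼_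
    ; ≈-trans  = ˢ-trans ≼-trans
    ; ≈-compat = ˢ-compatible 𝐌 {_≼_} ≼-compat
    }
  ; ≼-refl     = ≼-refl
  ; ≼-antisym  = λ a b → ≤-refl
  ; ≼-trans    = ≼-trans
  ; ≼-≈-compat = respects-ˢ ≼-trans
  ; ≼-compat   = ≼-compat
  }
  where
  open CompleteResiduatedLattice 𝐋 using (≤-refl)
  open LRelationProperties 𝐋
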